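{- Let $\psi$ be an $\textit{LTL}_f$ formula and $\phi=G\psi$ (i.e. $\phi=\mathsf{ff}\,R\,\psi$). Then $\phi$ is satisfiable as an $\textit{LTL}_f$ formula iff the propositional formula $\mathit{ofg}(\psi)$ is satisfiable (i.e. there is $A\in\Sigma$ with $A\models\mathit{ofg}(\psi)$).
   Context: Fix a finite set $\mathcal{P}$ of atomic propositions; $L=\mathcal{P}\cup\{\neg a: a\in\mathcal{P}\}$ is the set of literals and $\Sigma=2^{L}$. $\textit{LTL}_f$ formulas are in negation normal form: $\phi::=\mathsf{tt}\mid\mathsf{ff}\mid \ell\mid \phi\wedge\phi\mid\phi\vee\phi\mid X\phi\mid X_w\phi\mid \phi U\phi\mid\phi R\phi$, $\ell\in L$; $G\psi$ abbreviates $\mathsf{ff}\,R\,\psi$. Semantics on finite traces $\eta=\omega_0\ldots\omega_n\in\Sigma^*$ ($n\ge0$, $|\eta|=n+1$, $\eta_i=\omega_i\ldots\omega_n$): $\eta\models\mathsf{tt}$, $\eta\not\models\mathsf{ff}$; $\eta\models\ell$ iff $\ell\in\omega_0$; $\wedge,\vee$ as usual; $\eta\models X\psi$ iff $|\eta|>1$ and $\eta_1\models\psi$; $\eta\models X_w\psi$ iff $|\eta|=1$ or ($|\eta|>1$ and $\eta_1\models\psi$); $\eta\models\phi_1U\phi_2$ iff some $0\le i<|\eta|$ has $\eta_i\models\phi_2$ and $\eta_j\models\phi_1$ for all $j<i$; $\eta\models\phi_1R\phi_2$ iff either $\eta_i\models\phi_2$ for all $0\le i<|\eta|$, or some $0\le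 i<|\eta|$ has $\eta_i\models\phi_1$ and $\eta_j\models\phi_2$ for all $j\le i$. $\phi$ is satisfiable iff some finite trace satisfies it. A letter $A\in\Sigma$ is identified with the length-one trace, so $A\models\alpha$ is defined for propositional $\alpha$. Obligation formulas $\mathit{off},\mathit{ofr},\mathit{ofg}$ (propositional formulas), defined by induction; for $\mathit{ofx}$ ranging over all three: $\mathit{ofx}(\mathsf{tt})=\mathsf{tt}$, $\mathit{ofx}(\mathsf{ff})=\mathsf{ff}$, $\mathit{ofx}(\ell)=\ell$ for literals; $\mathit{ofx}(\phi_1\wedge\phi_2)=\mathit{ofx}(\phi_1)\wedge\mathit{ofx}(\phi_2)$; $\mathit{ofx}(\phi_1\vee\phi_2)=\mathit{ofx}(\phi_1)\vee\mathit{ofx}(\phi_2)$; $\mathit{ofx}(\phi_1U\phi_2)=\mathit{ofx}(\phi_2)$. For Next: $\mathit{off}(X\phi_2)=\mathit{off}(\phi_2)$, $\mathit{ofr}(X\phi_2)=\mathsf{ff}$, $\mathit{ofg}(X\phi_2)=\mathsf{ff}$; $\mathit{off}(X_w\phi_2)=\mathit{off}(\phi_2)$, $\mathit{ofr}(X_w\phi_2)=\mathsf{ff}$, $\mathit{ofg}(X_w\phi_2)=\mathsf{tt}$. For Release: $\mathit{off}(\phi_1R\phi_2)=\mathit{ofr}(\phi_2)$, $\mathit{ofr}(\phi_1R\phi_2)=\mathit{ofr}(\phi_2)$, $\mathit{ofg}(\phi_1R\phi_2)=\mathit{ofg}(\phi_2)$. -}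

module Defs where

open import Data.Nat using (ℕ; zero; suc; _<_; _≤_)
open import Data.Fin using (Fin)
open import Data.Bool using (Bool; true; false; T)
open import Data.List using (List; []; _∷_; length)
open import Data.Product using (_×_; Σ; _,_; ∃)
open import Data.Sum using (_⊎_)
open import Data.Unit using (⊤)
open import Data.Empty using (⊥)

data Lit (n : ℕ) : Set where
  pos : Fin n → Lit n
  neg : Fin n → Lit n

-- A letter A ∈ Σ = 2^L is a subset of the literals, given by its
-- characteristic function (no consistency requirement, as in Σ = 2^L).
Letter : ℕ → Set
Letter n = Lit n → Bool

-- LTLf formulas in negation normal form.
data LTL (n : ℕ) : Set where
  tt ff : LTL n
  lit   : Lit n → LTL n
  _∧_ _∨_ : LTL n → LTL n → LTL n
  X Xw  : LTL n → LTL n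
  _U_ _R_ : LTL n → LTL n → LTL n

G : ∀ {n} → LTL n → LTL n
G ψ = ff R ψ

-- A finite (nonempty) trace ω₀ ω₁ … ωₖ is represented by its first
-- letter and the list of remaining letters.
record Trace (n : ℕ) : Set where
  constructor _∷ₜ_
  field
    hd : Letter n
    tl : List (Letter n)
open Trace public

len : ∀ {n} → Trace n → ℕ
len (a ∷ₜ as) = suc (length as)

-- suffix η_i (for i ≥ |η| it returns the last suffix; only used with i < |η|)
suffix : ∀ {n} → Trace n → ℕ → Trace n
suffix η zero = η
suffix (a ∷ₜ []) (suc i) = a ∷ₜ []
suffix (a ∷ₜ (b ∷ bs)) (suc i) = suffix (b ∷ₜ bs) i

infix 4 _⊨_
_⊨_ : ∀ {n} → Trace n → LTL n → Set
η ⊨ tt = ⊤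
η ⊨ ff = ⊥
η ⊨ lit l = T (hd η l)
η ⊨ (φ ∧ ψ) = (η ⊨ φ) × (η ⊨ ψ)
η ⊨ (φ ∨ ψ) = (η ⊨ φ) ⊎ (η ⊨ ψ)
(a ∷ₜ []) ⊨ X φ = ⊥
(a ∷ₜ (b ∷ bs)) ⊨ X φ = (b ∷ₜ bs) ⊨ φ
(a ∷ₜ []) ⊨ Xw φ = ⊤
(a ∷ₜ (b ∷ bs)) ⊨ Xw φ = (b ∷ₜ bs) ⊨ φ
η ⊨ (φ₁ U φ₂) =
  Σ ℕ λ i → i < len η × (suffix η i ⊨ φ₂) × (∀ j → j < i → suffix η j ⊨ φ₁)
η ⊨ (φ₁ R φ₂) =
  (∀ i → i < len η → suffix η i ⊨ φ₂)
  ⊎ (Σ ℕ λ i → i < len η × (suffix η i ⊨ φ₁) × (∀ j → j ≤ i → suffix η j ⊨ φ₂))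

Satisfiable : ∀ {n} → LTL n → Set
Satisfiable φ = Σ (Trace _) λ η → η ⊨ φ

_⊨ₗ_ : ∀ {n} → Letter n → LTL n → Set
A ⊨ₗ α = (A ∷ₜ []) ⊨ α

mutual
  off : ∀ {n} → LTL n → LTL n
  off tt = tt
  off ff = ff
  off (lit l) = lit l
  off (φ ∧ ψ) = off φ ∧ off ψ
  off (φ ∨ ψ) = off φ ∨ off ψ
  off (X φ) = off φ
  off (Xw φ) = off φ
  off (φ U ψ) = off ψ
  off (φ R ψ) = ofr ψ

  ofr : ∀ {n} → LTL n → LTL n
  ofr tt = tt
  ofr ff = ff
  ofr (lit l) = lit l
  ofr (φ ∧ ψ) = ofr φ ∧ ofr ψ
  ofr (φ ∨ ψ) = ofr φ ∨ ofr ψ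
  ofr (X φ) = ff
  ofr (Xw φ) = ff
  ofr (φ U ψ) = ofr ψ
  ofr (φ R ψ) = ofr ψ

ofg : ∀ {n} → LTL n → LTL n
ofg tt = tt
ofg ff = ff
ofg (lit l) = lit l
ofg (φ ∧ ψ) = ofg φ ∧ ofg ψ
ofg (φ ∨ ψ) = ofg φ ∨ ofg ψ
ofg (X φ) = ff
ofg (Xw φ) = tt
ofg (φ U ψ) = ofg ψ
ofg (φ R ψ) = ofg ψ

-- On a trace, G ψ holds exactly when ψ holds at every suffix, so a model of
-- G ψ yields its last, one-letter suffix as a model of ψ, and a one-letter
-- model of ψ is already a model of G ψ. On one-letter traces ψ and ofg ψ
-- agree: X fails, Xw holds vacuously, and U and R reduce to their right
-- argument.
module Submission where

open import Defs
open import Data.Nat using (ℕ; zero; suc; s≤s; z≤n; _<_)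
open import Data.Product using (Σ; _×_; _,_)
open import Data.Sum using (inj₁; inj₂)
open import Data.List using (List; []; _∷_)
open import Data.Unit using (tt)

only-suffix : ∀ {n} {A : Letter n} (P : Trace n → Set) →
  P (A ∷ₜ []) → ∀ i → i < 1 → P (suffix (A ∷ₜ []) i)
only-suffix P p zero    _         = p
only-suffix P p (suc _) (s≤s ())

last-suffix : ∀ {n} (P : Trace n → Set) (A : Letter n) (As : List (Letter n)) →
  (∀ i → i < len (A ∷ₜ As) → P (suffix (A ∷ₜ As) i)) → Σ (Letter n) (λ B → P (B ∷ₜ []))
last-suffix P A []       p = A , p zero (s≤s z≤n)
last-suffix P A (B ∷ Bs) p = last-suffix P B Bs (λ i i<len → p (suc i) (s≤s i<len))

⊨ₗ⇒⊨ₗofg : ∀ {n} (A : Letter n) (ψ : LTL n) → A ⊨ₗ ψ → A ⊨ₗ ofg ψ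
⊨ₗ⇒⊨ₗofg A tt       p                         = p
⊨ₗ⇒⊨ₗofg A ff       p                         = p
⊨ₗ⇒⊨ₗofg A (lit l)  p                         = p
⊨ₗ⇒⊨ₗofg A (φ ∧ ψ)  (p , q)                   = ⊨ₗ⇒⊨ₗofg A φ p , ⊨ₗ⇒⊨ₗofg A ψ q
⊨ₗ⇒⊨ₗofg A (φ ∨ ψ)  (inj₁ p)                  = inj₁ (⊨ₗ⇒⊨ₗofg A φ p)
⊨ₗ⇒⊨ₗofg A (φ ∨ ψ)  (inj₂ q)                  = inj₂ (⊨ₗ⇒⊨ₗofg A ψ q)
⊨ₗ⇒⊨ₗofg A (Xw ψ)   p                         = tt
⊨ₗ⇒⊨ₗofg A (φ U ψ)  (zero , _ , p , _)        = ⊨ₗ⇒⊨ₗofg A ψ p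
⊨ₗ⇒⊨ₗofg A (φ U ψ)  (suc _ , s≤s () , _)
⊨ₗ⇒⊨ₗofg A (φ R ψ)  (inj₁ always)             = ⊨ₗ⇒⊨ₗofg A ψ (always zero (s≤s z≤n))
⊨ₗ⇒⊨ₗofg A (φ R ψ)  (inj₂ (zero , _ , _ , q)) = ⊨ₗ⇒⊨ₗofg A ψ (q zero z≤n)
⊨ₗ⇒⊨ₗofg A (φ R ψ)  (inj₂ (suc _ , s≤s () , _))

⊨ₗofg⇒⊨ₗ : ∀ {n} (A : Letter n) (ψ : LTL n) → A ⊨ₗ ofg ψ → A ⊨ₗ ψ
⊨ₗofg⇒⊨ₗ A tt      p        = p
⊨ₗofg⇒⊨ₗ A ff      p        = p
⊨ₗofg⇒⊨ₗ A (lit l) p        = p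
⊨ₗofg⇒⊨ₗ A (φ ∧ ψ) (p , q)  = ⊨ₗofg⇒⊨ₗ A φ p , ⊨ₗofg⇒⊨ₗ A ψ q
⊨ₗofg⇒⊨ₗ A (φ ∨ ψ) (inj₁ p) = inj₁ (⊨ₗofg⇒⊨ₗ A φ p)
⊨ₗofg⇒⊨ₗ A (φ ∨ ψ) (inj₂ q) = inj₂ (⊨ₗofg⇒⊨ₗ A ψ q)
⊨ₗofg⇒⊨ₗ A (Xw ψ)  p        = tt
⊨ₗofg⇒⊨ₗ A (φ U ψ) p        = zero , s≤s z≤n , ⊨ₗofg⇒⊨ₗ A ψ p , λ _ ()
⊨ₗofg⇒⊨ₗ A (φ R ψ) p        = inj₁ (only-suffix (_⊨ ψ) (⊨ₗofg⇒⊨ₗ A ψ p))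

⊨G⇒⊨-suffixes : ∀ {n} (η : Trace n) (ψ : LTL n) →
  η ⊨ G ψ → ∀ i → i < len η → suffix η i ⊨ ψ
⊨G⇒⊨-suffixes η ψ (inj₁ always) = always

⊨ₗ⇒⊨ₗG : ∀ {n} (A : Letter n) (ψ : LTL n) → A ⊨ₗ ψ → A ⊨ₗ G ψ
⊨ₗ⇒⊨ₗG A ψ p = inj₁ (only-suffix (_⊨ ψ) p)

theorem5 : (n : ℕ) (ψ : LTL n) →
    (Satisfiable (G ψ) → Σ (Letter n) (λ A → A ⊨ₗ ofg ψ))
    × (Σ (Letter n) (λ A → A ⊨ₗ ofg ψ) → Satisfiable (G ψ))
theorem5 n ψ = sat⇒ofg , ofg⇒sat
  where
  sat⇒ofg : Satisfiable (G ψ) → Σ (Letter n) (λ A → A ⊨ₗ ofg ψ)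
  sat⇒ofg (A ∷ₜ As , ⊨Gψ) =
    let B , B⊨ψ = last-suffix (_⊨ ψ) A As (⊨G⇒⊨-suffixes (A ∷ₜ As) ψ ⊨Gψ)
    in  B , ⊨ₗ⇒⊨ₗofg B ψ B⊨ψ

  ofg⇒sat : Σ (Letter n) (λ A → A ⊨ₗ ofg ψ) → Satisfiable (G ψ)
  ofg⇒sat (A , A⊨ofgψ) = (A ∷ₜ []) , ⊨ₗ⇒⊨ₗG A ψ (⊨ₗofg⇒⊨ₗ A ψ A⊨ofgψ)
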